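{- For every finite multiset $\Gamma$ of formulae of intuitionistic linear logic and every formula $\varphi$: if $\Gamma\vdash\varphi$ (derivability in the natural deduction system $\mathrm{N_{ILL}}$), then $\Gamma\Vdash\varphi$, i.e. $\Gamma\Vdash^{\varnothing}_{\mathcal{B}}\varphi$ holds for every base $\mathcal{B}$.
   Context: Fix a set $\mathbb{A}$ of propositional atoms. All multisets are finite; $\uplus$ denotes multiset union; an atomic multiset is a finite multiset of atoms. Formulae: $\varphi ::= p\in\mathbb{A}\mid\top\mid 0\mid 1\mid\varphi\multimap\varphi\mid\varphi\otimes\varphi\mid\varphi\mathbin{\&}\varphi\mid\varphi\oplus\varphi\mid\,!\varphi$. For a multiset $\Delta=\{\delta_1,\dots,\delta_k\}$, $!\Delta=\{!\delta_1,\dots,!\delta_k\}$. Natural deduction $\mathrm{N_{ILL}}$: $\Gamma\vdash\varphi$ ($\Gamma$ a possibly empty multiset of formulae) is the smallest relation closed under: (Ax) $\varphi\vdash\varphi$; ($\multimap$I) from $\Gamma\uplus\{\varphi\}\vdash\psi$ infer $\Gamma\vdash\varphi\multimap\psi$; ($\multimap$E) from $\Gamma\vdash\varphi\multimap\psi$ and $\Delta\vdash\varphi$ infer $\Gamma\uplus\Delta\vdash\psi$; ($\otimes$I) from $\Gamma\vdash\varphi$, $\Delta\vdash\psi$ infer $\Gamma\uplus\Delta\vdash\varphi\otimes\psi$; ($\otimes$E) from $\Gamma\vdash\varphi\otimes\psi$ and $\Delta\uplus\{\varphi,\psi\}\vdash\chi$ infer $\Gamma\uplus\Delta\vdash\chi$;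 ($1$I) $\vdash 1$; ($1$E) from $\Gamma\vdash 1$, $\Delta\vdash\varphi$ infer $\Gamma\uplus\Delta\vdash\varphi$; ($\mathbin{\&}$I) from $\Gamma\vdash\varphi$, $\Gamma\vdash\psi$ infer $\Gamma\vdash\varphi\mathbin{\&}\psi$; ($\mathbin{\&}$E) from $\Gamma\vdash\varphi\mathbin{\&}\psi$ infer $\Gamma\vdash\varphi$ and also $\Gamma\vdash\psi$; ($\oplus$I) from $\Gamma\vdash\varphi$ (resp. $\Gamma\vdash\psi$) infer $\Gamma\vdash\varphi\oplus\psi$; ($\oplus$E) from $\Gamma\vdash\varphi\oplus\psi$, $\Delta\uplus\{\varphi\}\vdash\chi$, $\Delta\uplus\{\psi\}\vdash\chi$ infer $\Gamma\uplus\Delta\vdash\chi$; ($\top$I, any $n\ge0$) from $\Gamma_i\vdash\varphi_i$ ($1\le i\le n$) infer $\Gamma_1\uplus\dots\uplus\Gamma_n\vdash\top$; ($0$E, any $n\ge 0$) from $\Gamma_i\vdash\varphi_i$ ($1\le i\le n$) and $\Delta\vdash 0$ infer $\Gamma_1\uplus\dots\uplus\Gamma_n\uplus\Delta\vdash\chi$; (Prom$_n$, any $n\ge0$) from $\Gamma_i\vdash\,!\psi_i$ ($1\le i\le n$) and $\{!\psi_1,\dots,!\psi_n\}\vdash\varphi$ infer $\Gamma_1\uplus\dots\uplus\Gamma_n\vdash\,!\varphi$; (Der) from $\Gamma\vdash\,!\varphi$, $\Delta\uplus\{\varphi\}\vdash\psi$ infer $\Gamma\uplus\Delta\vdash\psi$;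 (Wk) from $\Gamma\vdash\,!\varphi$, $\Delta\vdash\psi$ infer $\Gamma\uplus\Delta\vdash\psi$; (Ctr) from $\Gamma\vdash\,!\varphi$, $\Delta\uplus\{!\varphi,!\varphi\}\vdash\psi$ infer $\Gamma\uplus\Delta\vdash\psi$. Bases. An atomic sequent is a pair $P\Rightarrow p$ ($P$ atomic multiset, $p$ atom); an atomic box is a finite multiset of atomic sequents; an atomic rule is a triple $\langle\mathbf{A},\mathbf{S},p\rangle$ with $\mathbf{A}$ a finite multiset of atomic boxes, $\mathbf{S}$ an atomic box, $p$ an atom. A base is a set of atomic rules; $\mathcal{C}\supseteq\mathcal{B}$ is set inclusion. An atom $p$ is persistent in $\mathcal{B}$ if $\mathcal{B}$ contains a rule $\langle\varnothing,\mathbf{S},p\rangle$ with $\mathbf{S}\neq\varnothing$. Derivability $P\vdash_{\mathcal{B}}p$ is the smallest relation closed under: (Ref) $\{p\}\vdash_{\mathcal{B}}p$; (App) if $\langle\mathbf{A},\mathbf{S},p\rangle\in\mathcal{B}$ with $\mathbf{A}=\{\mathbf{T}_1,\dots,\mathbf{T}_m\}$, and there are $n\ge m$, atomic multisets $C_1,\dots,C_n$ and a multiset $D=\{d_{m+1},\dots,d_n\}$ of atoms persistent in $\mathcal{B}$ with $C_i\uplus Q\vdash_{\mathcal{B}}q$ for all $i\le m$ and $Q\Rightarrow q\in\mathbf{T}_i$, $C_j\vdash_{\mathcal{B}}d_j$ for all $m<j\le n$, and $D\uplus U\vdash_{\mathcal{B}}v$ for all $U\Rightarrow v\in\mathbf{S}$,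 then $C_1\uplus\dots\uplus C_n\vdash_{\mathcal{B}}p$. Support. For a base $\mathcal{B}$, atomic multiset $L$: (At) $\Vdash^L_{\mathcal{B}}p$ iff $L\vdash_{\mathcal{B}}p$; ($\multimap$) $\Vdash^L_{\mathcal{B}}\varphi\multimap\psi$ iff $\varphi\Vdash^L_{\mathcal{B}}\psi$; ($\otimes$) $\Vdash^L_{\mathcal{B}}\varphi\otimes\psi$ iff for all $\mathcal{C}\supseteq\mathcal{B}$, atomic multisets $K$, atoms $p$: if $\{\varphi,\psi\}\Vdash^K_{\mathcal{C}}p$ then $\Vdash^{L\uplus K}_{\mathcal{C}}p$; ($1$) $\Vdash^L_{\mathcal{B}}1$ iff for all $\mathcal{C}\supseteq\mathcal{B}$, $K$, $p$: if $\Vdash^K_{\mathcal{C}}p$ then $\Vdash^{L\uplus K}_{\mathcal{C}}p$; ($\mathbin{\&}$) $\Vdash^L_{\mathcal{B}}\varphi\mathbin{\&}\psi$ iff $\Vdash^L_{\mathcal{B}}\varphi$ and $\Vdash^L_{\mathcal{B}}\psi$; ($\oplus$) $\Vdash^L_{\mathcal{B}}\varphi\oplus\psi$ iff for all $\mathcal{C}\supseteq\mathcal{B}$, $K$, $p$: if $\varphi\Vdash^K_{\mathcal{C}}p$ and $\psi\Vdash^K_{\mathcal{C}}p$ then $\Vdash^{L\uplus K}_{\mathcal{C}}p$; ($0$) $\Vdash^L_{\mathcal{B}}0$ iff $\Vdash^{L\uplus K}_{\mathcal{B}}p$ for all atoms $p$ and atomic multisets $K$; ($\top$) $\Vdash^L_{\mathcal{B}}\top$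 always; ($!$) $\Vdash^L_{\mathcal{B}}\,!\varphi$ iff for all $\mathcal{C}\supseteq\mathcal{B}$, $K$, $p$: if (for all $\mathcal{D}\supseteq\mathcal{C}$, $\Vdash^{\varnothing}_{\mathcal{D}}\varphi$ implies $\Vdash^K_{\mathcal{D}}p$) then $\Vdash^{L\uplus K}_{\mathcal{C}}p$. Multisets: $\Vdash^L_{\mathcal{B}}\varnothing$ iff $L=\varnothing$; $\Vdash^L_{\mathcal{B}}\{\varphi\}$ iff $\Vdash^L_{\mathcal{B}}\varphi$; $\Vdash^L_{\mathcal{B}}\Gamma\uplus\Delta$ iff $L=K\uplus M$ for some $K,M$ with $\Vdash^K_{\mathcal{B}}\Gamma$, $\Vdash^M_{\mathcal{B}}\Delta$. (Inf) For non-empty $\Gamma$, write $\Gamma=\,!\Delta\uplus\Theta$ with $!\Delta$ the elements whose top-level connective is $!$ and $\Theta$ the rest; $\Gamma\Vdash^L_{\mathcal{B}}\varphi$ iff for all $\mathcal{C}\supseteq\mathcal{B}$ and atomic $K$: if $\Vdash^{\varnothing}_{\mathcal{C}}\delta$ for every $\delta\in\Delta$ and $\Vdash^K_{\mathcal{C}}\Theta$, then $\Vdash^{L\uplus K}_{\mathcal{C}}\varphi$. For $\Gamma=\varnothing$, $\Gamma\Vdash^L_{\mathcal{B}}\varphi$ means $\Vdash^L_{\mathcal{B}}\varphi$. Validity: $\Gamma\Vdash\varphi$ iff $\Gamma\Vdash^{\varnothing}_{\mathcal{B}}\varphi$ for every base $\mathcal{B}$. -}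

module Defs where

open import Level using (Level; Lift; lift) renaming (suc to lsuc; zero to lzero)
open import Data.Nat using (ℕ)
open import Data.Fin using (Fin)
open import Data.List using (List; []; _∷_; _++_; [_]; concat; tabulate; length; lookup)
open import Data.List.Membership.Propositional using (_∈_)
open import Data.List.Relation.Unary.All using (All)
open import Data.List.Relation.Binary.Permutation.Propositional using (_↭_)
open import Data.Product using (Σ; _×_; _,_; Σ-syntax)
open import Data.Unit.Polymorphic using (⊤)
open import Relation.Binary.PropositionalEquality using (_≡_; _≢_)

infixr 4 _⊸_
infixr 5 _⊕_
infixr 6 _&_
infixr 7 _⊗_
infix 9 !_

data Formula (Atom : Set) : Set where
  atom : Atom → Formula Atom
  ⊤ᶠ   : Formula Atom
  𝟎    : Formula Atom
  𝟏    : Formula Atom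
  _⊸_  : Formula Atom → Formula Atom → Formula Atom
  _⊗_  : Formula Atom → Formula Atom → Formula Atom
  _&_  : Formula Atom → Formula Atom → Formula Atom
  _⊕_  : Formula Atom → Formula Atom → Formula Atom
  !_   : Formula Atom → Formula Atom

module _ {Atom : Set} where

  private
    F = Formula Atom

  -- Multisets are lists; multiset union is _++_,
  -- and the rule `exch` makes derivability invariant under permutation,
  -- so that the relation on lists is exactly the multiset relation.

  infix 2 _⊢_

  data _⊢_ : List F → F → Set where
    exch : ∀ {Γ Γ' φ} → Γ ↭ Γ' → Γ ⊢ φ → Γ' ⊢ φ
    ax   : ∀ {φ} → [ φ ] ⊢ φ
    ⊸I   : ∀ {Γ φ ψ} → Γ ++ [ φ ] ⊢ ψ → Γ ⊢ φ ⊸ ψ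
    ⊸E   : ∀ {Γ Δ φ ψ} → Γ ⊢ φ ⊸ ψ → Δ ⊢ φ → Γ ++ Δ ⊢ ψ
    ⊗I   : ∀ {Γ Δ φ ψ} → Γ ⊢ φ → Δ ⊢ ψ → Γ ++ Δ ⊢ φ ⊗ ψ
    ⊗E   : ∀ {Γ Δ φ ψ χ} → Γ ⊢ φ ⊗ ψ → Δ ++ (φ ∷ ψ ∷ []) ⊢ χ → Γ ++ Δ ⊢ χ
    𝟏I   : [] ⊢ 𝟏
    𝟏E   : ∀ {Γ Δ φ} → Γ ⊢ 𝟏 → Δ ⊢ φ → Γ ++ Δ ⊢ φ
    &I   : ∀ {Γ φ ψ} → Γ ⊢ φ → Γ ⊢ ψ → Γ ⊢ φ & ψ
    &E₁  : ∀ {Γ φ ψ} → Γ ⊢ φ & ψ → Γ ⊢ φ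
    &E₂  : ∀ {Γ φ ψ} → Γ ⊢ φ & ψ → Γ ⊢ ψ
    ⊕I₁  : ∀ {Γ φ ψ} → Γ ⊢ φ → Γ ⊢ φ ⊕ ψ
    ⊕I₂  : ∀ {Γ φ ψ} → Γ ⊢ ψ → Γ ⊢ φ ⊕ ψ
    ⊕E   : ∀ {Γ Δ φ ψ χ} → Γ ⊢ φ ⊕ ψ → Δ ++ [ φ ] ⊢ χ → Δ ++ [ ψ ] ⊢ χ
         → Γ ++ Δ ⊢ χ
    ⊤I   : (n : ℕ) (Γs : Fin n → List F) (φs : Fin n → F)
         → ((i : Fin n) → Γs i ⊢ φs i)
         → concat (tabulate Γs) ⊢ ⊤ᶠ
    𝟎E   : (n : ℕ) (Γs : Fin n → List F) (φs : Fin n → F) {Δ : List F} {χ : F}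
         → ((i : Fin n) → Γs i ⊢ φs i)
         → Δ ⊢ 𝟎
         → concat (tabulate Γs) ++ Δ ⊢ χ
    prom : (n : ℕ) (Γs : Fin n → List F) (ψs : Fin n → F) {φ : F}
         → ((i : Fin n) → Γs i ⊢ ! ψs i)
         → tabulate (λ i → ! ψs i) ⊢ φ
         → concat (tabulate Γs) ⊢ ! φ
    der  : ∀ {Γ Δ φ ψ} → Γ ⊢ ! φ → Δ ++ [ φ ] ⊢ ψ → Γ ++ Δ ⊢ ψ
    wk   : ∀ {Γ Δ φ ψ} → Γ ⊢ ! φ → Δ ⊢ ψ → Γ ++ Δ ⊢ ψ
    ctr  : ∀ {Γ Δ φ ψ} → Γ ⊢ ! φ → Δ ++ (! φ ∷ ! φ ∷ []) ⊢ ψ → Γ ++ Δ ⊢ ψ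

  record ASequent : Set where
    constructor _⇒_
    field
      lhs : List Atom
      rhs : Atom
  open ASequent public

  Box : Set
  Box = List ASequent

  record Rule : Set where
    constructor ⟨_,_,_⟩
    field
      premises : List Box
      dbox     : Box
      concl    : Atom
  open Rule public

  Base : Set₁
  Base = Rule → Set

  infix 4 _⊆ᴮ_
  _⊆ᴮ_ : Base → Base → Set
  B ⊆ᴮ C = ∀ {r} → B r → C r

  Persistent : Base → Atom → Set
  Persistent B p = Σ[ S ∈ Box ] (S ≢ []) × B ⟨ [] , S , p ⟩

  data Deriv (B : Base) : List Atom → Atom → Set₁ where
    ref : ∀ {P p} → P ↭ [ p ] → Deriv B P p
    app : (r : Rule) → B r
        → (Cs : Fin (length (premises r)) → List Atom)
        → ((i : Fin (length (premises r))) → ∀ {s} → s ∈ lookup (premises r) i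
             → Deriv B (Cs i ++ lhs s) (rhs s))
        → (k : ℕ) (Es : Fin k → List Atom) (ds : Fin k → Atom)
        → ((j : Fin k) → Persistent B (ds j))
        → ((j : Fin k) → Deriv B (Es j) (ds j))
        → (∀ {s} → s ∈ dbox r → Deriv B (tabulate ds ++ lhs s) (rhs s))
        → ∀ {P} → P ↭ concat (tabulate Cs) ++ concat (tabulate Es)
        → Deriv B P (concl r)

  -- Inf1 C K φ  is the hypothesis of clause (Inf) for Γ = {φ}, i.e.
  --   "⊩^∅_C δ for δ ∈ Δ, and ⊩^K_C Θ" where {φ} = !Δ ⊎ Θ, unfolded.
  -- Inf2 C K φ ψ  is the same for Γ = {φ, ψ}.
  -- (They are unfolded by cases so that the definition is structurally
  --  recursive; see the general InfHyp below, which they agree with.)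

  mutual
    Supp : Base → List Atom → F → Set₁
    Supp B L (atom p) = Deriv B L p
    Supp B L (φ ⊸ ψ) =
      ∀ C → B ⊆ᴮ C → ∀ K → Inf1 C K φ → Supp C (L ++ K) ψ
    Supp B L (φ ⊗ ψ) =
      ∀ C → B ⊆ᴮ C → ∀ K p
      → (∀ D → C ⊆ᴮ D → ∀ K' → Inf2 D K' φ ψ → Deriv D (K ++ K') p)
      → Deriv C (L ++ K) p
    Supp B L 𝟏 =
      ∀ C → B ⊆ᴮ C → ∀ K p → Deriv C K p → Deriv C (L ++ K) p
    Supp B L (φ & ψ) = Supp B L φ × Supp B L ψ
    Supp B L (φ ⊕ ψ) =
      ∀ C → B ⊆ᴮ C → ∀ K p
      → (∀ D → C ⊆ᴮ D → ∀ K' → Inf1 D K' φ → Deriv D (K ++ K') p)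
      → (∀ D → C ⊆ᴮ D → ∀ K' → Inf1 D K' ψ → Deriv D (K ++ K') p)
      → Deriv C (L ++ K) p
    Supp B L 𝟎 = ∀ p K → Deriv B (L ++ K) p
    Supp B L ⊤ᶠ = ⊤
    Supp B L (! φ) =
      ∀ C → B ⊆ᴮ C → ∀ K p
      → (∀ D → C ⊆ᴮ D → Supp D [] φ → Deriv D K p)
      → Deriv C (L ++ K) p

    Inf1 : Base → List Atom → F → Set₁
    Inf1 C K (! δ) = Supp C [] δ × Lift (lsuc lzero) (K ≡ [])
    Inf1 C K φ     = Supp C K φ

    Inf2 : Base → List Atom → F → F → Set₁
    Inf2 C K (! δ) (! ε) = (Supp C [] δ × Supp C [] ε) × Lift (lsuc lzero) (K ≡ [])
    Inf2 C K (! δ) ψ     = Supp C [] δ × Supp C K ψ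
    Inf2 C K φ     (! ε) = Supp C [] ε × Supp C K φ
    Inf2 C K φ     ψ     = Σ[ K₁ ∈ List Atom ] Σ[ K₂ ∈ List Atom ]
                             (K ↭ K₁ ++ K₂) × Supp C K₁ φ × Supp C K₂ ψ

  bangs : List F → List F
  bangs []        = []
  bangs (! δ ∷ Γ) = δ ∷ bangs Γ
  bangs (φ ∷ Γ)   = bangs Γ

  rest : List F → List F
  rest []        = []
  rest (! δ ∷ Γ) = rest Γ
  rest (φ ∷ Γ)   = φ ∷ rest Γ

  SuppM : Base → List Atom → List F → Set₁
  SuppM B L []          = Lift (lsuc lzero) (L ≡ [])
  SuppM B L (φ ∷ [])    = Supp B L φ
  SuppM B L (φ ∷ ψ ∷ Γ) = Σ[ K ∈ List Atom ] Σ[ M ∈ List Atom ]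
                            (L ↭ K ++ M) × Supp B K φ × SuppM B M (ψ ∷ Γ)

  InfHyp : Base → List Atom → List F → Set₁
  InfHyp C K Γ = All (Supp C []) (bangs Γ) × SuppM C K (rest Γ)

  Inf : Base → List Atom → List F → F → Set₁
  Inf B L []      φ = Supp B L φ
  Inf B L (γ ∷ Γ) φ = ∀ C → B ⊆ᴮ C → ∀ K → InfHyp C K (γ ∷ Γ) → Supp C (L ++ K) φ

  Valid : List F → F → Set₁
  Valid Γ φ = ∀ (B : Base) → Inf B [] Γ φ

  -- Sanity check: Inf1 is the (Inf) hypothesis for a singleton.

  private
    open import Data.List.Relation.Unary.All using ([]; _∷_)

    inf1→ : ∀ C K φ → Inf1 C K φ → InfHyp C K (φ ∷ [])
    inf1→ C K (atom p) h = [] , h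
    inf1→ C K ⊤ᶠ h = [] , h
    inf1→ C K 𝟎 h = [] , h
    inf1→ C K 𝟏 h = [] , h
    inf1→ C K (φ ⊸ ψ) h = [] , h
    inf1→ C K (φ ⊗ ψ) h = [] , h
    inf1→ C K (φ & ψ) h = [] , h
    inf1→ C K (φ ⊕ ψ) h = [] , h
    inf1→ C K (! φ) (h , e) = (h ∷ []) , e

    inf1← : ∀ C K φ → InfHyp C K (φ ∷ []) → Inf1 C K φ
    inf1← C K (atom p) (_ , h) = h
    inf1← C K ⊤ᶠ (_ , h) = h
    inf1← C K 𝟎 (_ , h) = h
    inf1← C K 𝟏 (_ , h) = h
    inf1← C K (φ ⊸ ψ) (_ , h) = h
    inf1← C K (φ ⊗ ψ) (_ , h) = h
    inf1← C K (φ & ψ) (_ , h) = h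
    inf1← C K (φ ⊕ ψ) (_ , h) = h
    inf1← C K (! φ) (h ∷ [] , e) = h , e

{-# OPTIONS --safe #-}
-- The proof is by induction on derivations, for the local consequence Γ ⊨ φ in which each
-- hypothesis is supported by its own share of the atomic resources (a banged one by none).
-- The key notion is Elim B L H: in every extension of B, the resources L can be traded for
-- resources satisfying H when deriving an atom.  The support clauses of ⊗, ⊕, 𝟏 and ! say
-- that a formula is such an elimination, but only towards atomic goals; Elim-bind lifts
-- this to every conclusion χ by induction on χ.  Every elimination rule, and every use of a
-- supported formula as a hypothesis, is then an instance of Elim-bind.
module Submission where

open import Defs
open import Algebra.Bundles using (CommutativeMonoid)
open import Data.Empty using (⊥)
open import Data.Fin using (Fin; zero; suc)
open import Data.List using (List; []; _∷_; _++_; [_]; concat; tabulate)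
import Data.List.Relation.Binary.Permutation.Propositional as ↭
open ↭ using (_↭_; ↭-refl; ↭-sym; ↭-trans)
open import Data.List.Relation.Binary.Permutation.Propositional.Properties
  using (↭-empty-inv; ++⁺ˡ; ++⁺ʳ; ++-comm; ++-assoc; ++-identityʳ; shifts; ++-commutativeMonoid)
open import Data.List.Relation.Unary.All using (All; []; _∷_)
open import Data.Nat using (zero; suc)
open import Data.Product using (Σ-syntax; _×_; _,_; proj₁; proj₂)
open import Data.Sum using (_⊎_; inj₁; inj₂; [_,_]′)
open import Data.Unit.Polymorphic using (tt)
import Data.Vec.Functional as Vector
open import Function using (_⇔_; mk⇔; Equivalence; id)
open import Function.Construct.Identity using (⇔-id)
open import Level using (Lift; lift)
open import Relation.Binary.PropositionalEquality using (_≡_; refl)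

module _ {Atom : Set} where

  open import Algebra.Properties.CommutativeSemigroup
    (CommutativeMonoid.commutativeSemigroup (++-commutativeMonoid {A = Atom}))
    using (xy∙z≈xz∙y)

  private
    F = Formula Atom

    variable
      B C D : Base {Atom}
      K L M : List Atom
      p : Atom
      φ ψ χ δ : F
      Γ Δ : List F

  Deriv-resp-↭ : L ↭ M → Deriv B L p → Deriv B M p
  Deriv-resp-↭ π (ref ρ) = ref (↭-trans (↭-sym π) ρ)
  Deriv-resp-↭ π (app r b Cs dCs k Es ds pers dEs dS ρ) =
    app r b Cs dCs k Es ds pers dEs dS (↭-trans (↭-sym π) ρ)

  Deriv-mono : B ⊆ᴮ C → Deriv B L p → Deriv C L p
  Deriv-mono s (ref ρ) = ref ρ
  Deriv-mono {B = B} {C = C} s (app r b Cs dCs k Es ds pers dEs dS ρ) =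
    app r (s b) Cs (λ i m → Deriv-mono s (dCs i m)) k Es ds
      (λ j → persistent (pers j)) (λ j → Deriv-mono s (dEs j))
      (λ m → Deriv-mono s (dS m)) ρ
    where
      persistent : ∀ {q} → Persistent B q → Persistent C q
      persistent (S , S≢[] , r) = S , S≢[] , s r

  Supp-mono : ∀ φ → B ⊆ᴮ C → Supp B L φ → Supp C L φ
  Supp-mono (atom p) s h         = Deriv-mono s h
  Supp-mono ⊤ᶠ       s h         = h
  Supp-mono 𝟎        s h p K     = Deriv-mono s (h p K)
  Supp-mono 𝟏        s h C t     = h C (λ b → t (s b))
  Supp-mono (φ ⊸ ψ)  s h C t     = h C (λ b → t (s b))
  Supp-mono (φ ⊗ ψ)  s h C t     = h C (λ b → t (s b))
  Supp-mono (φ & ψ)  s (a , b)   = Supp-mono φ s a , Supp-mono ψ s b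
  Supp-mono (φ ⊕ ψ)  s h C t     = h C (λ b → t (s b))
  Supp-mono (! φ)    s h C t     = h C (λ b → t (s b))

  Supp-resp-↭ : ∀ φ → L ↭ M → Supp B L φ → Supp B M φ
  Supp-resp-↭ (atom p) π h                = Deriv-resp-↭ π h
  Supp-resp-↭ ⊤ᶠ       π h                = h
  Supp-resp-↭ 𝟎        π h p K            = Deriv-resp-↭ (++⁺ʳ K π) (h p K)
  Supp-resp-↭ 𝟏        π h C t K p d      = Deriv-resp-↭ (++⁺ʳ K π) (h C t K p d)
  Supp-resp-↭ (φ ⊸ ψ)  π h C t K i        = Supp-resp-↭ ψ (++⁺ʳ K π) (h C t K i)
  Supp-resp-↭ (φ ⊗ ψ)  π h C t K p g      = Deriv-resp-↭ (++⁺ʳ K π) (h C t K p g)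
  Supp-resp-↭ (φ & ψ)  π (a , b)          = Supp-resp-↭ φ π a , Supp-resp-↭ ψ π b
  Supp-resp-↭ (φ ⊕ ψ)  π h C t K p g₁ g₂  = Deriv-resp-↭ (++⁺ʳ K π) (h C t K p g₁ g₂)
  Supp-resp-↭ (! φ)    π h C t K p g      = Deriv-resp-↭ (++⁺ʳ K π) (h C t K p g)

  Pred : Set₂
  Pred = Base {Atom} → List Atom → Set₁

  private variable
    H H' H₁ H₂ : Pred

  Monotone : Pred → Set₁
  Monotone H = ∀ {B C K} → B ⊆ᴮ C → H B K → H C K

  Emp : Pred
  Emp _ K = Lift _ (K ≡ [])

  infixr 7 _∗_
  _∗_ : Pred → Pred → Pred
  (H₁ ∗ H₂) C K = Σ[ K₁ ∈ List Atom ] Σ[ K₂ ∈ List Atom ] (K ↭ K₁ ++ K₂) × H₁ C K₁ × H₂ C K₂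

  Hyp : F → Pred
  Hyp φ C K = Inf1 C K φ

  -- Inf1 is defined with a catch-all clause, so it does not compute on a variable
  -- formula; this view recovers its two cases.
  data Inf1View : F → Set₁ where
    banged : ∀ δ → Inf1View (! δ)
    plain  : (∀ {C K} → Inf1 C K φ → Supp C K φ) → (∀ {C K} → Supp C K φ → Inf1 C K φ)
           → Inf1View φ

  inf1-view : ∀ φ → Inf1View φ
  inf1-view (atom _) = plain id id
  inf1-view ⊤ᶠ       = plain id id
  inf1-view 𝟎        = plain id id
  inf1-view 𝟏        = plain id id
  inf1-view (_ ⊸ _)  = plain id id
  inf1-view (_ ⊗ _)  = plain id id
  inf1-view (_ & _)  = plain id id
  inf1-view (_ ⊕ _)  = plain id id
  inf1-view (! δ)    = banged δ

  Hyp-mono : ∀ φ → Monotone (Hyp φ)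
  Hyp-mono φ with inf1-view φ
  ... | banged δ      = λ { s (h , e) → Supp-mono δ s h , e }
  ... | plain to from = λ s h → from (Supp-mono φ s (to h))

  Hyp-resp-↭ : ∀ φ → L ↭ M → Hyp φ C L → Hyp φ C M
  Hyp-resp-↭ φ with inf1-view φ
  ... | banged δ      = λ { π (h , lift refl) → h , lift (↭-empty-inv (↭-sym π)) }
  ... | plain to from = λ π h → from (Supp-resp-↭ φ π (to h))

  -- Supp B L (φ ⊗ ψ) is, by definition, Elim B L (λ D K → Inf2 D K φ ψ).
  Elim : Base → List Atom → Pred → Set₁
  Elim B L H = ∀ C → B ⊆ᴮ C → ∀ K p
             → (∀ D → C ⊆ᴮ D → ∀ K' → H D K' → Deriv D (K ++ K') p)
             → Deriv C (L ++ K) p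

  Elim-return : Monotone H → H B L → Elim B L H
  Elim-return {L = L} H-mono h C s K p g = Deriv-resp-↭ (++-comm K L) (g C id L (H-mono s h))

  Elim-map : (∀ {D K} → H D K → H' D K) → Elim B L H → Elim B L H'
  Elim-map f e C s K p g = e C s K p (λ D t K' h → g D t K' (f h))

  Elim-mono : B ⊆ᴮ C → Elim B L H → Elim C L H
  Elim-mono s e C' t = e C' (λ b → t (s b))

  Elim-resp-↭ : L ↭ M → Elim B L H → Elim B M H
  Elim-resp-↭ π e C s K p g = Deriv-resp-↭ (++⁺ʳ K π) (e C s K p g)

  Elim-Emp : Elim B [] Emp
  Elim-Emp C s K p g = Deriv-resp-↭ (++-identityʳ K) (g C id [] (lift refl))

  Elim-∗ : Monotone H₁ → Elim B L H₁ → Elim B M H₂ → Elim B (L ++ M) (H₁ ∗ H₂)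
  Elim-∗ {L = L} {M = M} H₁-mono e₁ e₂ C s K p g =
    Deriv-resp-↭ (↭-sym (++-assoc L M K)) (e₁ C s (M ++ K) p λ D t K₁ h₁ →
      Deriv-resp-↭ (↭-sym (++-assoc M K K₁)) (e₂ D (λ b → t (s b)) (K ++ K₁) p λ D' t' K₂ h₂ →
        Deriv-resp-↭ (↭-sym (++-assoc K K₁ K₂))
          (g D' (λ c → t' (t c)) (K₁ ++ K₂) (K₁ , K₂ , ↭-refl , H₁-mono t' h₁ , h₂))))

  Elim-frame : Elim B L H → ∀ C → B ⊆ᴮ C → ∀ K K'' p
             → (∀ D → C ⊆ᴮ D → ∀ K' → H D K' → Deriv D ((K ++ K') ++ K'') p)
             → Deriv C ((L ++ K) ++ K'') p
  Elim-frame {L = L} e C s K K'' p g =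
    Deriv-resp-↭ (↭-sym (++-assoc L K K''))
      (e C s (K ++ K'') p λ D t K' h → Deriv-resp-↭ (xy∙z≈xz∙y K K' K'') (g D t K' h))

  Elim-bind : ∀ χ → Elim B L H → (∀ D → B ⊆ᴮ D → ∀ K' → H D K' → Supp D (K ++ K') χ)
            → Supp B (L ++ K) χ
  Elim-bind {B = B} {K = K} (atom q) e f = e B id K q f
  Elim-bind ⊤ᶠ e f = tt
  Elim-bind {B = B} {K = K} 𝟎 e f q K'' =
    Elim-frame e B id K K'' q λ D t K' h → f D t K' h q K''
  Elim-bind {K = K} 𝟏 e f C s K'' q d =
    Elim-frame e C s K K'' q λ D t K' h → f D (λ b → t (s b)) K' h D id K'' q (Deriv-mono t d)
  Elim-bind {L = L} {K = K} (α ⊸ β) e f C s K'' i =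
    Supp-resp-↭ β (↭-sym (++-assoc L K K''))
      (Elim-bind β (Elim-mono s e) λ D t K' h →
        Supp-resp-↭ β (xy∙z≈xz∙y K K' K'')
          (f D (λ b → t (s b)) K' h D id K'' (Hyp-mono α t i)))
  Elim-bind {K = K} (α ⊗ β) e f C s K'' q g =
    Elim-frame e C s K K'' q λ D t K' h →
      f D (λ b → t (s b)) K' h D id K'' q (λ D' t' → g D' (λ c → t' (t c)))
  Elim-bind (α & β) e f = Elim-bind α e (λ D t K' h → proj₁ (f D t K' h))
                        , Elim-bind β e (λ D t K' h → proj₂ (f D t K' h))
  Elim-bind {K = K} (α ⊕ β) e f C s K'' q g₁ g₂ =
    Elim-frame e C s K K'' q λ D t K' h →
      f D (λ b → t (s b)) K' h D id K'' q
        (λ D' t' → g₁ D' (λ c → t' (t c))) (λ D' t' → g₂ D' (λ c → t' (t c)))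
  Elim-bind {K = K} (! α) e f C s K'' q g =
    Elim-frame e C s K K'' q λ D t K' h →
      f D (λ b → t (s b)) K' h D id K'' q (λ D' t' → g D' (λ c → t' (t c)))

  !⇒Elim : ∀ δ → Supp B L (! δ) → Elim B L (Hyp (! δ))
  !⇒Elim δ h C s K p g =
    h C s K p λ D t a → Deriv-resp-↭ (++-identityʳ K) (g D t [] (a , lift refl))

  Elim⇒! : ∀ δ → Elim B L (Hyp (! δ)) → Supp B L (! δ)
  Elim⇒! δ e C s K p g =
    e C s K p λ { D t .[] (a , lift refl) → Deriv-resp-↭ (↭-sym (++-identityʳ K)) (g D t a) }

  dereliction : ∀ δ → Supp B L (! δ) → Supp B L δ
  dereliction {L = L} δ h =
    Supp-resp-↭ δ (++-identityʳ L) (Elim-bind δ (!⇒Elim δ h) λ { D t .[] (a , lift refl) → a })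

  Hyp⇒Supp : ∀ φ → Hyp φ C K → Supp C K φ
  Hyp⇒Supp φ with inf1-view φ
  ... | banged δ     = λ h → Elim⇒! δ (Elim-return (Hyp-mono (! δ)) h)
  ... | plain to _   = to

  Supp⇒Hyp : ∀ φ → Supp C [] φ → Hyp φ C []
  Supp⇒Hyp φ with inf1-view φ
  ... | banged δ     = λ h → dereliction δ h , lift refl
  ... | plain _ from = from

  Supp⇒Elim : ∀ φ → Supp C L φ → Elim C L (Hyp φ)
  Supp⇒Elim φ with inf1-view φ
  ... | banged δ     = !⇒Elim δ
  ... | plain _ from = λ h → Elim-return (Hyp-mono φ) (from h)

  𝟏⇒Elim : Supp B L 𝟏 → Elim B L Emp
  𝟏⇒Elim h C s K p g = h C s K p (Deriv-resp-↭ (++-identityʳ K) (g C id [] (lift refl)))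

  𝟎⇒Elim : Supp B L 𝟎 → Elim B L (λ _ _ → Lift _ ⊥)
  𝟎⇒Elim h C s K p _ = Deriv-mono s (h p K)

  ⊕⇒Elim : ∀ φ ψ → Supp B L (φ ⊕ ψ) → Elim B L (λ D K → Hyp φ D K ⊎ Hyp ψ D K)
  ⊕⇒Elim φ ψ h C s K p g =
    h C s K p (λ D t K' a → g D t K' (inj₁ a)) (λ D t K' b → g D t K' (inj₂ b))

  Elim⇒⊕ : ∀ φ ψ → Elim B L (λ D K → Hyp φ D K ⊎ Hyp ψ D K) → Supp B L (φ ⊕ ψ)
  Elim⇒⊕ φ ψ e C s K p g₁ g₂ = e C s K p λ D t K' → [ g₁ D t K' , g₂ D t K' ]′

  Sep : (F → Pred) → List F → Pred
  Sep P []      = Emp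
  Sep P (φ ∷ Γ) = P φ ∗ Sep P Γ

  Hyps : List F → Pred
  Hyps = Sep Hyp

  Supps : List F → Pred
  Supps = Sep (λ φ C K → Supp C K φ)

  module Sep-Properties (P : F → Pred) where

    Sep-[_] : ∀ φ → P φ C K → Sep P [ φ ] C K
    Sep-[_] {K = K} φ a = K , [] , ↭-sym (++-identityʳ K) , a , lift refl

    Sep-mono : (∀ φ → Monotone (P φ)) → ∀ Γ → Monotone (Sep P Γ)
    Sep-mono P-mono []      s e                        = e
    Sep-mono P-mono (φ ∷ Γ) s (K₁ , K₂ , π , a , as) =
      K₁ , K₂ , π , P-mono φ s a , Sep-mono P-mono Γ s as

    Sep-++⁻ : ∀ Γ → Sep P (Γ ++ Δ) C K → (Sep P Γ ∗ Sep P Δ) C K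
    Sep-++⁻ {K = K} [] as = [] , K , ↭-refl , lift refl , as
    Sep-++⁻ (φ ∷ Γ) (K₁ , K₂ , π , a , as) =
      let (K₂₁ , K₂₂ , ρ , bs , cs) = Sep-++⁻ Γ as in
      K₁ ++ K₂₁ , K₂₂ , ↭-trans π (↭-trans (++⁺ˡ K₁ ρ) (↭-sym (++-assoc K₁ K₂₁ K₂₂))) ,
      (K₁ , K₂₁ , ↭-refl , a , bs) , cs

    Sep-++⁺ : ∀ Γ Δ → Sep P Γ C K → Sep P Δ C L → Sep P (Γ ++ Δ) C (K ++ L)
    Sep-++⁺ []      Δ (lift refl)              bs = bs
    Sep-++⁺ {L = L} (φ ∷ Γ) Δ (K₁ , K₂ , π , a , as) bs =
      K₁ , K₂ ++ L , ↭-trans (++⁺ʳ L π) (++-assoc K₁ K₂ L) , a , Sep-++⁺ Γ Δ as bs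

    Sep-↭ : Γ ↭ Δ → Sep P Γ C K → Sep P Δ C K
    Sep-↭ ↭.refl          as = as
    Sep-↭ (↭.prep φ π)    (K₁ , K₂ , ρ , a , as) = K₁ , K₂ , ρ , a , Sep-↭ π as
    Sep-↭ (↭.swap φ ψ π)  (K₁ , K₂ , ρ , a , K₃ , K₄ , ρ' , b , as) =
      K₃ , K₁ ++ K₄ , ↭-trans ρ (↭-trans (++⁺ˡ K₁ ρ') (shifts K₁ K₃)) ,
      b , (K₁ , K₄ , ↭-refl , a , Sep-↭ π as)
    Sep-↭ (↭.trans π π') as = Sep-↭ π' (Sep-↭ π as)

    Sep-concat⁻ : ∀ n (Γs : Fin n → List F) → Sep P (concat (tabulate Γs)) C K
                → Σ[ Ks ∈ (Fin n → List Atom) ]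
                    (K ↭ concat (tabulate Ks)) × (∀ i → Sep P (Γs i) C (Ks i))
    Sep-concat⁻ zero    Γs (lift refl) = (λ ()) , ↭-refl , λ ()
    Sep-concat⁻ (suc n) Γs as =
      let (K₁ , K₂ , π , bs , cs) = Sep-++⁻ (Γs zero) as
          (Ks , ρ , css)          = Sep-concat⁻ n (λ i → Γs (suc i)) cs
      in (K₁ Vector.∷ Ks) , ↭-trans π (++⁺ˡ K₁ ρ) , λ { zero → bs ; (suc i) → css i }

    Sep-tabulate⁺ : ∀ n (φs : Fin n → F) (Ks : Fin n → List Atom)
                  → (∀ i → P (φs i) C (Ks i)) → Sep P (tabulate φs) C (concat (tabulate Ks))
    Sep-tabulate⁺ zero    φs Ks as = lift refl
    Sep-tabulate⁺ (suc n) φs Ks as =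
      Ks zero , _ , ↭-refl , as zero ,
      Sep-tabulate⁺ n (λ i → φs (suc i)) (λ i → Ks (suc i)) (λ i → as (suc i))

  open Sep-Properties Hyp
  open Sep-Properties (λ φ C K → Supp C K φ) using ()
    renaming (Sep-[_] to Supps-[_]; Sep-tabulate⁺ to Supps-tabulate⁺)

  Hyps-mono : ∀ Γ → Monotone (Hyps Γ)
  Hyps-mono = Sep-mono Hyp-mono

  Hyps-!⇒[] : ∀ n (ψs : Fin n → F) → Hyps (tabulate (λ i → ! ψs i)) C K → K ≡ []
  Hyps-!⇒[] zero    ψs (lift refl) = refl
  Hyps-!⇒[] (suc n) ψs (K₁ , K₂ , π , (_ , lift refl) , hs)
    with Hyps-!⇒[] n (λ i → ψs (suc i)) hs
  ... | refl = ↭-empty-inv π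

  Supps⇒Elim : ∀ Γ → Supps Γ C L → Elim C L (Hyps Γ)
  Supps⇒Elim []      (lift refl)              = Elim-Emp
  Supps⇒Elim (φ ∷ Γ) (L₁ , L₂ , π , a , as) =
    Elim-resp-↭ (↭-sym π) (Elim-∗ (Hyp-mono φ) (Supp⇒Elim φ a) (Supps⇒Elim Γ as))

  !∗⇔ : ∀ ψ → (Supp C [] δ × Hyp ψ C K) ⇔ (Hyp (! δ) ∗ Hyp ψ) C K
  !∗⇔ {K = K} ψ = mk⇔
    (λ { (a , b) → [] , K , ↭-refl , (a , lift refl) , b })
    (λ { (_ , _ , π , (a , lift refl) , b) → a , Hyp-resp-↭ ψ (↭-sym π) b })

  ∗!⇔ : ∀ φ → (Supp C [] δ × Hyp φ C K) ⇔ (Hyp φ ∗ Hyp (! δ)) C K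
  ∗!⇔ {K = K} φ = mk⇔
    (λ { (b , a) → K , [] , ↭-sym (++-identityʳ K) , a , (b , lift refl) })
    (λ { (K₁ , _ , π , a , (b , lift refl)) →
         b , Hyp-resp-↭ φ (↭-sym (↭-trans π (++-identityʳ K₁))) a })

  !∗!⇔ : ((Supp C [] δ × Supp C [] ψ) × Emp C K) ⇔ (Hyp (! δ) ∗ Hyp (! ψ)) C K
  !∗!⇔ = mk⇔
    (λ { ((a , b) , lift refl) → [] , [] , ↭-refl , (a , lift refl) , (b , lift refl) })
    (λ { (_ , _ , π , (a , lift refl) , (b , lift refl)) → (a , b) , lift (↭-empty-inv π) })

  -- Inf2 is defined by overlapping clauses, so it only computes once both
  -- formulae are constructor-headed: hence the exhaustive case split.
  Inf2⇔ : ∀ φ ψ → Inf2 C K φ ψ ⇔ (Hyp φ ∗ Hyp ψ) C K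
  Inf2⇔ (! δ) (! ε)              = !∗!⇔
  Inf2⇔ (! δ) ψ@(atom _)         = !∗⇔ ψ
  Inf2⇔ (! δ) ψ@⊤ᶠ               = !∗⇔ ψ
  Inf2⇔ (! δ) ψ@𝟎                = !∗⇔ ψ
  Inf2⇔ (! δ) ψ@𝟏                = !∗⇔ ψ
  Inf2⇔ (! δ) ψ@(_ ⊸ _)          = !∗⇔ ψ
  Inf2⇔ (! δ) ψ@(_ ⊗ _)          = !∗⇔ ψ
  Inf2⇔ (! δ) ψ@(_ & _)          = !∗⇔ ψ
  Inf2⇔ (! δ) ψ@(_ ⊕ _)          = !∗⇔ ψ
  Inf2⇔ φ@(atom _) (! ε)         = ∗!⇔ φ
  Inf2⇔ φ@⊤ᶠ (! ε)               = ∗!⇔ φ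
  Inf2⇔ φ@𝟎 (! ε)                = ∗!⇔ φ
  Inf2⇔ φ@𝟏 (! ε)                = ∗!⇔ φ
  Inf2⇔ φ@(_ ⊸ _) (! ε)          = ∗!⇔ φ
  Inf2⇔ φ@(_ ⊗ _) (! ε)          = ∗!⇔ φ
  Inf2⇔ φ@(_ & _) (! ε)          = ∗!⇔ φ
  Inf2⇔ φ@(_ ⊕ _) (! ε)          = ∗!⇔ φ
  Inf2⇔ (atom _) (atom _)        = ⇔-id _
  Inf2⇔ (atom _) ⊤ᶠ              = ⇔-id _
  Inf2⇔ (atom _) 𝟎               = ⇔-id _
  Inf2⇔ (atom _) 𝟏               = ⇔-id _
  Inf2⇔ (atom _) (_ ⊸ _)         = ⇔-id _
  Inf2⇔ (atom _) (_ ⊗ _)         = ⇔-id _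
  Inf2⇔ (atom _) (_ & _)         = ⇔-id _
  Inf2⇔ (atom _) (_ ⊕ _)         = ⇔-id _
  Inf2⇔ ⊤ᶠ (atom _)              = ⇔-id _
  Inf2⇔ ⊤ᶠ ⊤ᶠ                    = ⇔-id _
  Inf2⇔ ⊤ᶠ 𝟎                     = ⇔-id _
  Inf2⇔ ⊤ᶠ 𝟏                     = ⇔-id _
  Inf2⇔ ⊤ᶠ (_ ⊸ _)               = ⇔-id _
  Inf2⇔ ⊤ᶠ (_ ⊗ _)               = ⇔-id _
  Inf2⇔ ⊤ᶠ (_ & _)               = ⇔-id _
  Inf2⇔ ⊤ᶠ (_ ⊕ _)               = ⇔-id _
  Inf2⇔ 𝟎 (atom _)               = ⇔-id _
  Inf2⇔ 𝟎 ⊤ᶠ                     = ⇔-id _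
  Inf2⇔ 𝟎 𝟎                      = ⇔-id _
  Inf2⇔ 𝟎 𝟏                      = ⇔-id _
  Inf2⇔ 𝟎 (_ ⊸ _)                = ⇔-id _
  Inf2⇔ 𝟎 (_ ⊗ _)                = ⇔-id _
  Inf2⇔ 𝟎 (_ & _)                = ⇔-id _
  Inf2⇔ 𝟎 (_ ⊕ _)                = ⇔-id _
  Inf2⇔ 𝟏 (atom _)               = ⇔-id _
  Inf2⇔ 𝟏 ⊤ᶠ                     = ⇔-id _
  Inf2⇔ 𝟏 𝟎                      = ⇔-id _
  Inf2⇔ 𝟏 𝟏                      = ⇔-id _
  Inf2⇔ 𝟏 (_ ⊸ _)                = ⇔-id _
  Inf2⇔ 𝟏 (_ ⊗ _)                = ⇔-id _
  Inf2⇔ 𝟏 (_ & _)                = ⇔-id _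
  Inf2⇔ 𝟏 (_ ⊕ _)                = ⇔-id _
  Inf2⇔ (_ ⊸ _) (atom _)         = ⇔-id _
  Inf2⇔ (_ ⊸ _) ⊤ᶠ               = ⇔-id _
  Inf2⇔ (_ ⊸ _) 𝟎                = ⇔-id _
  Inf2⇔ (_ ⊸ _) 𝟏                = ⇔-id _
  Inf2⇔ (_ ⊸ _) (_ ⊸ _)          = ⇔-id _
  Inf2⇔ (_ ⊸ _) (_ ⊗ _)          = ⇔-id _
  Inf2⇔ (_ ⊸ _) (_ & _)          = ⇔-id _
  Inf2⇔ (_ ⊸ _) (_ ⊕ _)          = ⇔-id _
  Inf2⇔ (_ ⊗ _) (atom _)         = ⇔-id _
  Inf2⇔ (_ ⊗ _) ⊤ᶠ               = ⇔-id _
  Inf2⇔ (_ ⊗ _) 𝟎                = ⇔-id _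
  Inf2⇔ (_ ⊗ _) 𝟏                = ⇔-id _
  Inf2⇔ (_ ⊗ _) (_ ⊸ _)          = ⇔-id _
  Inf2⇔ (_ ⊗ _) (_ ⊗ _)          = ⇔-id _
  Inf2⇔ (_ ⊗ _) (_ & _)          = ⇔-id _
  Inf2⇔ (_ ⊗ _) (_ ⊕ _)          = ⇔-id _
  Inf2⇔ (_ & _) (atom _)         = ⇔-id _
  Inf2⇔ (_ & _) ⊤ᶠ               = ⇔-id _
  Inf2⇔ (_ & _) 𝟎                = ⇔-id _
  Inf2⇔ (_ & _) 𝟏                = ⇔-id _
  Inf2⇔ (_ & _) (_ ⊸ _)          = ⇔-id _
  Inf2⇔ (_ & _) (_ ⊗ _)          = ⇔-id _
  Inf2⇔ (_ & _) (_ & _)          = ⇔-id _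
  Inf2⇔ (_ & _) (_ ⊕ _)          = ⇔-id _
  Inf2⇔ (_ ⊕ _) (atom _)         = ⇔-id _
  Inf2⇔ (_ ⊕ _) ⊤ᶠ               = ⇔-id _
  Inf2⇔ (_ ⊕ _) 𝟎                = ⇔-id _
  Inf2⇔ (_ ⊕ _) 𝟏                = ⇔-id _
  Inf2⇔ (_ ⊕ _) (_ ⊸ _)          = ⇔-id _
  Inf2⇔ (_ ⊕ _) (_ ⊗ _)          = ⇔-id _
  Inf2⇔ (_ ⊕ _) (_ & _)          = ⇔-id _
  Inf2⇔ (_ ⊕ _) (_ ⊕ _)          = ⇔-id _

  ⊗-intro : ∀ φ ψ → Supp C K φ → Supp C L ψ → Supp C (K ++ L) (φ ⊗ ψ)
  ⊗-intro φ ψ a b =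
    Elim-map (Equivalence.from (Inf2⇔ φ ψ)) (Elim-∗ (Hyp-mono φ) (Supp⇒Elim φ a) (Supp⇒Elim ψ b))

  ⊸-apply : ∀ φ ψ → Supp C K (φ ⊸ ψ) → Supp C L φ → Supp C (K ++ L) ψ
  ⊸-apply {K = K} {L = L} φ ψ f a =
    Supp-resp-↭ ψ (++-comm L K) (Elim-bind ψ (Supp⇒Elim φ a) f)

  ⊕-intro₁ : ∀ φ ψ → Supp C K φ → Supp C K (φ ⊕ ψ)
  ⊕-intro₁ φ ψ a = Elim⇒⊕ φ ψ (Elim-map inj₁ (Supp⇒Elim φ a))

  ⊕-intro₂ : ∀ φ ψ → Supp C K ψ → Supp C K (φ ⊕ ψ)
  ⊕-intro₂ φ ψ b = Elim⇒⊕ φ ψ (Elim-map inj₂ (Supp⇒Elim ψ b))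

  infix 2 _⊨_
  _⊨_ : List F → F → Set₁
  Γ ⊨ φ = ∀ C K → Hyps Γ C K → Supp C K φ

  ⊨-exch : Γ ↭ Δ → Γ ⊨ φ → Δ ⊨ φ
  ⊨-exch π d C K hs = d C K (Sep-↭ (↭-sym π) hs)

  ⊨-ax : ∀ φ → [ φ ] ⊨ φ
  ⊨-ax φ C K (K₁ , _ , π , h , lift refl) =
    Supp-resp-↭ φ (↭-sym (↭-trans π (++-identityʳ K₁))) (Hyp⇒Supp φ h)

  ⊨-⊸I : ∀ Γ → Γ ++ [ φ ] ⊨ ψ → Γ ⊨ φ ⊸ ψ
  ⊨-⊸I {φ = φ} Γ d C K hs D s K' h =
    d D (K ++ K') (Sep-++⁺ Γ [ φ ] (Hyps-mono Γ s hs) (Sep-[ φ ] h))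

  ⊨-split : ∀ Γ Δ φ ψ χ → (∀ {C K L} → Supp C K φ → Supp C L ψ → Supp C (K ++ L) χ)
          → Γ ⊨ φ → Δ ⊨ ψ → Γ ++ Δ ⊨ χ
  ⊨-split Γ Δ φ ψ χ combine d e C K hs =
    let (K₁ , K₂ , π , hΓ , hΔ) = Sep-++⁻ Γ hs in
    Supp-resp-↭ χ (↭-sym π) (combine (d C K₁ hΓ) (e C K₂ hΔ))

  ⊨-elim : ∀ Γ Δ → (∀ {C K} → Hyps Γ C K → Elim C K H)
         → (∀ {D K K'} → Hyps Δ D K → H D K' → Supp D (K ++ K') χ)
         → Γ ++ Δ ⊨ χ
  ⊨-elim {χ = χ} Γ Δ e f C K hs =
    let (K₁ , K₂ , π , hΓ , hΔ) = Sep-++⁻ Γ hs in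
    Supp-resp-↭ χ (↭-sym π) (Elim-bind χ (e hΓ) λ D s K' h → f (Hyps-mono Δ s hΔ) h)

  ⊨-cut : ∀ Γ Δ Σ → (∀ {C K} → Hyps Γ C K → Elim C K (Hyps Σ)) → Δ ++ Σ ⊨ χ → Γ ++ Δ ⊨ χ
  ⊨-cut Γ Δ Σ e d = ⊨-elim Γ Δ e λ hΔ hΣ → d _ _ (Sep-++⁺ Δ Σ hΔ hΣ)

  ⊨-⊗E : ∀ Γ Δ → Γ ⊨ φ ⊗ ψ → Δ ++ (φ ∷ ψ ∷ []) ⊨ χ → Γ ++ Δ ⊨ χ
  ⊨-⊗E {φ = φ} {ψ = ψ} Γ Δ d = ⊨-cut Γ Δ (φ ∷ ψ ∷ []) λ hs → Elim-map pair (d _ _ hs)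
    where
      pair : Inf2 D K φ ψ → Hyps (φ ∷ ψ ∷ []) D K
      pair h = let (K₁ , K₂ , π , a , b) = Equivalence.to (Inf2⇔ φ ψ) h in
               K₁ , K₂ , π , a , Sep-[ ψ ] b

  ⊨-𝟏E : ∀ Γ Δ → Γ ⊨ 𝟏 → Δ ⊨ φ → Γ ++ Δ ⊨ φ
  ⊨-𝟏E Γ Δ d e =
    ⊨-cut Γ Δ [] (λ hs → 𝟏⇒Elim (d _ _ hs)) (⊨-exch (↭-sym (++-identityʳ Δ)) e)

  ⊨-⊕E : ∀ Γ Δ → Γ ⊨ φ ⊕ ψ → Δ ++ [ φ ] ⊨ χ → Δ ++ [ ψ ] ⊨ χ → Γ ++ Δ ⊨ χ
  ⊨-⊕E {φ = φ} {ψ = ψ} Γ Δ d e₁ e₂ = ⊨-elim Γ Δ (λ hs → ⊕⇒Elim φ ψ (d _ _ hs)) λ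
    { hΔ (inj₁ a) → e₁ _ _ (Sep-++⁺ Δ [ φ ] hΔ (Sep-[ φ ] a))
    ; hΔ (inj₂ b) → e₂ _ _ (Sep-++⁺ Δ [ ψ ] hΔ (Sep-[ ψ ] b)) }

  ⊨-𝟎E : ∀ Γ Δ → Δ ⊨ 𝟎 → Γ ++ Δ ⊨ χ
  ⊨-𝟎E Γ Δ d = ⊨-exch (++-comm Δ Γ) (⊨-elim Δ Γ (λ hs → 𝟎⇒Elim (d _ _ hs)) λ _ ())

  ⊨-prom : ∀ n Γs (ψs : Fin n → F) → (∀ i → Γs i ⊨ ! ψs i) → tabulate (λ i → ! ψs i) ⊨ φ
         → concat (tabulate Γs) ⊨ ! φ
  ⊨-prom {φ = φ} n Γs ψs ds d C K hs =
    let (Ks , π , hss) = Sep-concat⁻ n Γs hs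
        premises       = Supps-tabulate⁺ n (λ i → ! ψs i) Ks λ i → ds i C (Ks i) (hss i)
    in Supp-resp-↭ (! φ) (↭-sym π) (Elim⇒! φ (Elim-map promote (Supps⇒Elim !ψs premises)))
    where
      !ψs = tabulate (λ i → ! ψs i)

      promote : Hyps !ψs D L → Hyp (! φ) D L
      promote hs with Hyps-!⇒[] n ψs hs
      ... | refl = d _ [] hs , lift refl

  ⊨-der : ∀ Γ Δ → Γ ⊨ ! φ → Δ ++ [ φ ] ⊨ ψ → Γ ++ Δ ⊨ ψ
  ⊨-der {φ = φ} Γ Δ d = ⊨-cut Γ Δ [ φ ] λ hs →
    Elim-map (λ { (a , lift refl) → Sep-[ φ ] (Supp⇒Hyp φ a) }) (!⇒Elim φ (d _ _ hs))

  ⊨-wk : ∀ Γ Δ → Γ ⊨ ! φ → Δ ⊨ ψ → Γ ++ Δ ⊨ ψ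
  ⊨-wk {φ = φ} Γ Δ d e =
    ⊨-cut Γ Δ [] (λ hs → Elim-map proj₂ (!⇒Elim φ (d _ _ hs)))
      (⊨-exch (↭-sym (++-identityʳ Δ)) e)

  ⊨-ctr : ∀ Γ Δ → Γ ⊨ ! φ → Δ ++ (! φ ∷ ! φ ∷ []) ⊨ ψ → Γ ++ Δ ⊨ ψ
  ⊨-ctr {φ = φ} Γ Δ d = ⊨-cut Γ Δ (! φ ∷ ! φ ∷ []) λ hs →
    Elim-map (λ { h@(_ , lift refl) → [] , [] , ↭-refl , h , Sep-[ ! φ ] h })
      (!⇒Elim φ (d _ _ hs))

  sound : Γ ⊢ φ → Γ ⊨ φ
  sound (exch π d)                 = ⊨-exch π (sound d)
  sound (ax {φ})                   = ⊨-ax φ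
  sound (⊸I {Γ} d)                 = ⊨-⊸I Γ (sound d)
  sound (⊸E {Γ} {Δ} {φ} {ψ} d e)   = ⊨-split Γ Δ (φ ⊸ ψ) φ ψ (⊸-apply φ ψ) (sound d) (sound e)
  sound (⊗I {Γ} {Δ} {φ} {ψ} d e)   = ⊨-split Γ Δ φ ψ (φ ⊗ ψ) (⊗-intro φ ψ) (sound d) (sound e)
  sound (⊗E {Γ} {Δ} d e)           = ⊨-⊗E Γ Δ (sound d) (sound e)
  sound 𝟏I _ .[] (lift refl) _ _ _ _ d = d
  sound (𝟏E {Γ} {Δ} d e)           = ⊨-𝟏E Γ Δ (sound d) (sound e)
  sound (&I d e) C K hs            = sound d C K hs , sound e C K hs
  sound (&E₁ d) C K hs             = proj₁ (sound d C K hs)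
  sound (&E₂ d) C K hs             = proj₂ (sound d C K hs)
  sound (⊕I₁ {φ = φ} {ψ} d) C K hs = ⊕-intro₁ φ ψ (sound d C K hs)
  sound (⊕I₂ {φ = φ} {ψ} d) C K hs = ⊕-intro₂ φ ψ (sound d C K hs)
  sound (⊕E {Γ} {Δ} d e₁ e₂)       = ⊨-⊕E Γ Δ (sound d) (sound e₁) (sound e₂)
  sound (⊤I _ _ _ _) _ _ _         = tt
  sound (𝟎E _ Γs _ {Δ} _ d)        = ⊨-𝟎E (concat (tabulate Γs)) Δ (sound d)
  sound (prom n Γs ψs ds d)        = ⊨-prom n Γs ψs (λ i → sound (ds i)) (sound d)
  sound (der {Γ} {Δ} d e)          = ⊨-der Γ Δ (sound d) (sound e)
  sound (wk {Γ} {Δ} d e)           = ⊨-wk Γ Δ (sound d) (sound e)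
  sound (ctr {Γ} {Δ} d e)          = ⊨-ctr Γ Δ (sound d) (sound e)

  SuppM⇒Supps : ∀ Γ → SuppM C K Γ → Supps Γ C K
  SuppM⇒Supps []          s                      = s
  SuppM⇒Supps (φ ∷ [])    s                      = Supps-[ φ ] s
  SuppM⇒Supps (φ ∷ ψ ∷ Γ) (K₁ , K₂ , π , s , ss) = K₁ , K₂ , π , s , SuppM⇒Supps (ψ ∷ Γ) ss

  InfHyp⇒Hyps : ∀ Γ → All (Supp C []) (bangs Γ) → Supps (rest Γ) C K → Hyps Γ C K
  InfHyp⇒Hyps []        []       ss = ss
  InfHyp⇒Hyps (! δ ∷ Γ) (a ∷ as) ss = [] , _ , ↭-refl , (a , lift refl) , InfHyp⇒Hyps Γ as ss
  InfHyp⇒Hyps (atom _  ∷ Γ) as (K₁ , K₂ , π , s , ss) = K₁ , K₂ , π , s , InfHyp⇒Hyps Γ as ss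
  InfHyp⇒Hyps (⊤ᶠ      ∷ Γ) as (K₁ , K₂ , π , s , ss) = K₁ , K₂ , π , s , InfHyp⇒Hyps Γ as ss
  InfHyp⇒Hyps (𝟎       ∷ Γ) as (K₁ , K₂ , π , s , ss) = K₁ , K₂ , π , s , InfHyp⇒Hyps Γ as ss
  InfHyp⇒Hyps (𝟏       ∷ Γ) as (K₁ , K₂ , π , s , ss) = K₁ , K₂ , π , s , InfHyp⇒Hyps Γ as ss
  InfHyp⇒Hyps ((_ ⊸ _) ∷ Γ) as (K₁ , K₂ , π , s , ss) = K₁ , K₂ , π , s , InfHyp⇒Hyps Γ as ss
  InfHyp⇒Hyps ((_ ⊗ _) ∷ Γ) as (K₁ , K₂ , π , s , ss) = K₁ , K₂ , π , s , InfHyp⇒Hyps Γ as ss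
  InfHyp⇒Hyps ((_ & _) ∷ Γ) as (K₁ , K₂ , π , s , ss) = K₁ , K₂ , π , s , InfHyp⇒Hyps Γ as ss
  InfHyp⇒Hyps ((_ ⊕ _) ∷ Γ) as (K₁ , K₂ , π , s , ss) = K₁ , K₂ , π , s , InfHyp⇒Hyps Γ as ss

mainTheorem1 : {Atom : Set} (Γ : List (Formula Atom)) (φ : Formula Atom)
    → Γ ⊢ φ → Valid Γ φ
mainTheorem1 []      φ d B = sound d B [] (lift refl)
mainTheorem1 (γ ∷ Γ) φ d B C _ K (as , ss) =
  sound d C K (InfHyp⇒Hyps (γ ∷ Γ) as (SuppM⇒Supps (rest (γ ∷ Γ)) ss))
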